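{- Let $\Psi\subset\Delta^+_\ell$ be a root ideal and $i\in[\ell-1]$ such that $\tau_i\Psi=\Psi$. Then for any $\gamma\in\mathbb Z^\ell$, $$H(\Psi;\gamma)+H(\Psi;\epsilon_{i+1}-\epsilon_i+\tau_i\gamma)=0.$$
   Context: For $\gamma\in\mathbb Z^\ell$, $s_\gamma=\det(h_{\gamma_i+j-i})_{1\le i,j\le\ell}$ ($h_0=1$, $h_d=0$ for $d<0$); $\epsilon_i$ standard basis vectors of $\mathbb Z^\ell$. $\Delta^+_\ell=\{(i,j):1\le i<j\le\ell\}$ with order $(a,b)\le(c,d)$ iff $a\ge c$ and $b\le d$; a root ideal is an upper order ideal. $H(\Psi;\gamma)$ is obtained by expanding $\prod_{(i,j)\in\Psi}(1-tz_i/z_j)^{ -1}z^\gamma$ as a power series in $t$ and applying coefficientwise the linear map $z^\beta\mapsto s_\beta$. $\tau_i$ is the simple transposition $(i\ i+1)$; it acts on $\gamma$ by swapping $\gamma_i,\gamma_{i+1}$, and on subsets of $[\ell]\times[\ell]$ by $\tau_i\Psi=\{(\tau_i(a),\tau_i(b)):(a,b)\in\Psi\}$. -}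

module Defs where

open import Level using (Level)
open import Data.Bool using (Bool; true; false; if_then_else_)
open import Data.Nat as ℕ using (ℕ; zero; suc; _∸_)
open import Data.Integer as ℤ using (ℤ; +_; -[1+_])
open import Data.Fin as Fin using (Fin; zero; suc; toℕ; punchIn; _≟_)
open import Data.Product using (_×_; _,_)
open import Data.List using (List; []; _∷_; map; concatMap; upTo; allFin; filterᵇ; length; cartesianProduct)
open import Data.Vec using (Vec; []; _∷_)
open import Relation.Nullary using (does)
open import Relation.Binary.PropositionalEquality using (_≡_)
open import Algebra.Bundles using (CommutativeRing)

Subset² : ℕ → Set
Subset² ℓ = Fin ℓ → Fin ℓ → Bool

-- Ψ ⊆ Δ⁺_ℓ and Ψ is an upper order ideal for the order
-- (a,b) ≤ (c,d) iff a ≥ c and b ≤ d.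
IsRootIdeal : ∀ {ℓ} → Subset² ℓ → Set
IsRootIdeal {ℓ} Ψ =
  (∀ a b → Ψ a b ≡ true → a Fin.< b) ×
  (∀ a b c d → Ψ a b ≡ true → c Fin.≤ a → b Fin.≤ d → Ψ c d ≡ true)

transp : ∀ {ℓ} → Fin ℓ → Fin ℓ → Fin ℓ → Fin ℓ
transp i j k = if does (k ≟ i) then j else (if does (k ≟ j) then i else k)

ε : ∀ {ℓ} → Fin ℓ → Fin ℓ → ℤ
ε a x = if does (a ≟ x) then + 1 else + 0

rootsOf : ∀ {ℓ} → Subset² ℓ → List (Fin ℓ × Fin ℓ)
rootsOf {ℓ} Ψ = filterᵇ (λ { (a , b) → Ψ a b }) (cartesianProduct (allFin ℓ) (allFin ℓ))

compositions : (k n : ℕ) → List (Vec ℕ k)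
compositions zero zero = [] ∷ []
compositions zero (suc n) = []
compositions (suc k) n = concatMap (λ a → map (a ∷_) (compositions k (n ∸ a))) (upTo (suc n))

-- γ + Σ_r m_r (ε_{a_r} - ε_{b_r}), i.e. the exponent of z in
-- ∏_r (t z_{a_r}/z_{b_r})^{m_r} z^γ
shiftBy : ∀ {ℓ} (rs : List (Fin ℓ × Fin ℓ)) → Vec ℕ (length rs) → (Fin ℓ → ℤ) → (Fin ℓ → ℤ)
shiftBy [] [] γ = γ
shiftBy ((a , b) ∷ rs) (m ∷ v) γ =
  shiftBy rs v (λ x → γ x ℤ.+ (+ m) ℤ.* (ε a x ℤ.- ε b x))

-- The ring of symmetric functions Λ is the free
-- commutative ring on h_1, h_2, ...; we work in an arbitrary commutative
-- ring R with an arbitrary sequence h (h 0 = 1 is imposed in the statement).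

module _ {c r : Level} (R : CommutativeRing c r) where
  open CommutativeRing R using (_+_; _*_; -_; 0#; 1#) renaming (Carrier to A)

  sumFin : ∀ n → (Fin n → A) → A
  sumFin zero f = 0#
  sumFin (suc n) f = f zero + sumFin n (λ k → f (suc k))

  sumList : List A → A
  sumList [] = 0#
  sumList (x ∷ xs) = x + sumList xs

  sign : ℕ → A
  sign zero = 1#
  sign (suc k) = - sign k

  det : ∀ n → (Fin n → Fin n → A) → A
  det zero M = 1#
  det (suc n) M =
    sumFin (suc n) (λ j → sign (toℕ j) * (M zero j * det n (λ r k → M (suc r) (punchIn j k))))

  hℤ : (ℕ → A) → ℤ → A
  hℤ h (+ n) = h n
  hℤ h -[1+ n ] = 0#

  schur : (ℕ → A) → ∀ ℓ → (Fin ℓ → ℤ) → A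
  schur h ℓ γ = det ℓ (λ i j → hℤ h (γ i ℤ.+ + toℕ j ℤ.- + toℕ i))

  -- coefficient of t^n in H(Ψ;γ)
  coeffH : (ℕ → A) → ∀ ℓ → Subset² ℓ → (Fin ℓ → ℤ) → ℕ → A
  coeffH h ℓ Ψ γ n =
    sumList (map (λ v → schur h ℓ (shiftBy (rootsOf Ψ) v γ))
                 (compositions (length (rootsOf Ψ)) n))

module Submission where

open import Defs
open import Level using (Level)
open import Data.Bool using (Bool; T; true; false; if_then_else_)
open import Data.Nat as ℕ using (ℕ; zero; suc; _∸_; _<ᵇ_; s≤s)
import Data.Nat.Properties as ℕ
open import Data.Integer as ℤ using (ℤ; +_)
open import Data.Integer.Tactic.RingSolver using (solve-∀)
open import Data.Fin as Fin using (Fin; zero; suc; toℕ; punchIn; _≟_)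
import Data.Fin.Properties as Fin
open import Data.Product as Product using (_×_; _,_; proj₁; proj₂; uncurry)
open import Data.List using (List; []; _∷_; map; _++_; concatMap; applyUpTo; upTo; length; allFin; cartesianProduct)
import Data.List.Properties as List
open import Data.List.Membership.Propositional using (_∈_)
open import Data.List.Membership.Propositional.Properties using (∈-filter⁺; ∈-filter⁻; ∈-cartesianProduct⁺; ∈-allFin; ∈-map⁺; ∈-map⁻)
open import Data.List.Membership.Propositional.Properties.WithK using (unique∧set⇒bag)
import Data.List.Relation.Unary.Unique.Propositional.Properties as Unique
open import Data.List.Relation.Binary.BagAndSetEquality using (∼bag⇒↭)
open import Data.List.Relation.Binary.Permutation.Propositional as ↭ using (_↭_)
open import Data.Vec using ([]; _∷_)
open import Function using (_∘_; id)
open import Function.Bundles using (mk⇔)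
open import Relation.Nullary using (Dec; does; yes; no)
open import Relation.Nullary.Decidable using (dec-true; dec-false; does-⇔; T?)
open import Relation.Binary.PropositionalEquality as ≡ using (_≡_; _≢_; refl)
open import Algebra.Bundles using (CommutativeRing)
import Algebra.Solver.CommutativeMonoid as CommutativeMonoidSolver

-- Write σγ = ε_{i+1} − ε_i + τ_i γ (straighten i (i+1) γ).  The Jacobi–Trudi matrix of σγ is that of γ with
-- rows i and i+1 exchanged, so s_{σγ} = − s_γ.  Shifting the exponent by a root commutes
-- with σ once τ_i is applied to the root, so the t^n-coefficient of H(Ψ;σγ) is minus that
-- of H(τ_iΨ;γ).  Finally τ_iΨ = Ψ makes the roots of τ_iΨ a permutation of those of Ψ,
-- and the coefficients of H do not depend on the order in which the roots are listed.

transp-source : ∀ {ℓ} (i j : Fin ℓ) → transp i j i ≡ j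
transp-source i j rewrite dec-true (i ≟ i) refl = refl

transp-target : ∀ {ℓ} {i j : Fin ℓ} → j ≢ i → transp i j j ≡ i
transp-target {i = i} {j} j≢i rewrite dec-false (j ≟ i) j≢i | dec-true (j ≟ j) refl = refl

transp-fixed : ∀ {ℓ} {i j x : Fin ℓ} → x ≢ i → x ≢ j → transp i j x ≡ x
transp-fixed {i = i} {j} {x} x≢i x≢j rewrite dec-false (x ≟ i) x≢i | dec-false (x ≟ j) x≢j = refl

transp-involutive : ∀ {ℓ} (i j x : Fin ℓ) → transp i j (transp i j x) ≡ x
transp-involutive i j x = byCases i j x (x ≟ i) (x ≟ j) (j ≟ i)
  where
  byCases : ∀ {ℓ} (i j x : Fin ℓ) → Dec (x ≡ i) → Dec (x ≡ j) → Dec (j ≡ i) →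
            transp i j (transp i j x) ≡ x
  byCases i j x (yes refl) _ (yes refl) =
    ≡.trans (≡.cong (transp x x) (transp-source x x)) (transp-source x x)
  byCases i j x (yes refl) _ (no j≢x) =
    ≡.trans (≡.cong (transp x j) (transp-source x j)) (transp-target j≢x)
  byCases i j x (no x≢i) (yes refl) _ =
    ≡.trans (≡.cong (transp i x) (transp-target x≢i)) (transp-source i x)
  byCases i j x (no x≢i) (no x≢j) _ =
    ≡.trans (≡.cong (transp i j) (transp-fixed x≢i x≢j)) (transp-fixed x≢i x≢j)

transp-injective : ∀ {ℓ} (i j : Fin ℓ) {x y : Fin ℓ} → transp i j x ≡ transp i j y → x ≡ y
transp-injective i j {x} {y} eq =
  ≡.trans (≡.sym (transp-involutive i j x))
          (≡.trans (≡.cong (transp i j) eq) (transp-involutive i j y))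

transp-suc : ∀ {ℓ} (i j r : Fin ℓ) → transp (suc i) (suc j) (suc r) ≡ suc (transp i j r)
transp-suc i j r with does (r ≟ i)
... | true  = refl
... | false with does (r ≟ j)
...   | true  = refl
...   | false = refl

ε-diag : ∀ {ℓ} (a : Fin ℓ) → ε a a ≡ + 1
ε-diag a rewrite dec-true (a ≟ a) refl = refl

ε-offdiag : ∀ {ℓ} {a x : Fin ℓ} → a ≢ x → ε a x ≡ + 0
ε-offdiag {a = a} {x} a≢x rewrite dec-false (a ≟ x) a≢x = refl

ε-transp : ∀ {ℓ} (i j a x : Fin ℓ) → ε (transp i j a) (transp i j x) ≡ ε a x
ε-transp i j a x =
  ≡.cong (λ b → if b then + 1 else + 0)
    (does-⇔ (mk⇔ (transp-injective i j) (≡.cong (transp i j))) (transp i j a ≟ transp i j x) (a ≟ x))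

straighten : ∀ {ℓ} → Fin ℓ → Fin ℓ → (Fin ℓ → ℤ) → Fin ℓ → ℤ
straighten i j γ x = ε j x ℤ.- ε i x ℤ.+ γ (transp i j x)

jtIndex : ∀ {ℓ} → (Fin ℓ → ℤ) → Fin ℓ → Fin ℓ → ℤ
jtIndex γ r c = γ r ℤ.+ + toℕ c ℤ.- + toℕ r

successor⇒≢ : ∀ {ℓ} {i j : Fin ℓ} → toℕ j ≡ suc (toℕ i) → j ≢ i
successor⇒≢ j≡1+i j≡i = ℕ.1+n≢n (≡.trans (≡.sym j≡1+i) (≡.cong toℕ j≡i))

jtIndex-straighten : ∀ {ℓ} {i j : Fin ℓ} → toℕ j ≡ suc (toℕ i) → ∀ γ r c →
                     jtIndex (straighten i j γ) r c ≡ jtIndex γ (transp i j r) c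
jtIndex-straighten {i = i} {j} j≡1+i γ r c = byRow j≡1+i γ r c (r ≟ i) (r ≟ j)
  where
  lowerRow : ∀ g c t → (+ 0 ℤ.- + 1 ℤ.+ g) ℤ.+ c ℤ.- t ≡ g ℤ.+ c ℤ.- (+ 1 ℤ.+ t)
  lowerRow = solve-∀
  raiseRow : ∀ g c t → (+ 1 ℤ.- + 0 ℤ.+ g) ℤ.+ c ℤ.- (+ 1 ℤ.+ t) ≡ g ℤ.+ c ℤ.- t
  raiseRow = solve-∀
  keepRow : ∀ g c t → (+ 0 ℤ.- + 0 ℤ.+ g) ℤ.+ c ℤ.- t ≡ g ℤ.+ c ℤ.- t
  keepRow = solve-∀

  byRow : ∀ {ℓ} {i j : Fin ℓ} → toℕ j ≡ suc (toℕ i) → ∀ γ r c → Dec (r ≡ i) → Dec (r ≡ j) →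
          jtIndex (straighten i j γ) r c ≡ jtIndex γ (transp i j r) c
  byRow {j = j} j≡1+i γ r c (yes refl) _
    rewrite transp-source r j | ε-diag r | ε-offdiag (successor⇒≢ j≡1+i) | j≡1+i
    = lowerRow (γ j) (+ toℕ c) (+ toℕ r)
  byRow {i = i} j≡1+i γ r c (no r≢i) (yes refl)
    rewrite transp-target {i = i} r≢i | ε-diag r | ε-offdiag (r≢i ∘ ≡.sym) | j≡1+i
    = raiseRow (γ i) (+ toℕ c) (+ toℕ i)
  byRow j≡1+i γ r c (no r≢i) (no r≢j)
    rewrite transp-fixed r≢i r≢j | ε-offdiag (r≢i ∘ ≡.sym) | ε-offdiag (r≢j ∘ ≡.sym)
    = keepRow (γ r) (+ toℕ c) (+ toℕ r)

shift : ∀ {ℓ} → Fin ℓ × Fin ℓ → ℕ → (Fin ℓ → ℤ) → Fin ℓ → ℤ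
shift (a , b) m γ x = γ x ℤ.+ (+ m) ℤ.* (ε a x ℤ.- ε b x)

shiftBy-cong : ∀ {ℓ} (rs : List (Fin ℓ × Fin ℓ)) v {γ γ′ : Fin ℓ → ℤ} →
               (∀ x → γ x ≡ γ′ x) → ∀ x → shiftBy rs v γ x ≡ shiftBy rs v γ′ x
shiftBy-cong []       []      γ≗γ′ = γ≗γ′
shiftBy-cong (_ ∷ rs) (_ ∷ v) γ≗γ′ = shiftBy-cong rs v (λ x → ≡.cong (ℤ._+ _) (γ≗γ′ x))

shift-comm : ∀ {ℓ} (r s : Fin ℓ × Fin ℓ) a b γ x → shift r a (shift s b γ) x ≡ shift s b (shift r a γ) x
shift-comm _ _ _ _ γ x = swapLast (γ x) _ _
  where
  swapLast : ∀ g p q → g ℤ.+ p ℤ.+ q ≡ g ℤ.+ q ℤ.+ p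
  swapLast = solve-∀

transp² : ∀ {ℓ} → Fin ℓ → Fin ℓ → Fin ℓ × Fin ℓ → Fin ℓ × Fin ℓ
transp² i j (a , b) = transp i j a , transp i j b

shift-straighten : ∀ {ℓ} (i j : Fin ℓ) r a γ x →
                   shift r a (straighten i j γ) x ≡ straighten i j (shift (transp² i j r) a γ) x
shift-straighten i j (p , q) a γ x rewrite ε-transp i j p x | ε-transp i j q x =
  reassoc (ε j x) (ε i x) (γ (transp i j x)) ((+ a) ℤ.* (ε p x ℤ.- ε q x))
  where
  reassoc : ∀ e e′ g d → (e ℤ.- e′ ℤ.+ g) ℤ.+ d ≡ e ℤ.- e′ ℤ.+ (g ℤ.+ d)
  reassoc = solve-∀

transp²-involutive : ∀ {ℓ} (i j : Fin ℓ) r → transp² i j (transp² i j r) ≡ r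
transp²-involutive i j (a , b) = ≡.cong₂ _,_ (transp-involutive i j a) (transp-involutive i j b)

-- (j , k) : Fin (suc m) × Fin m encodes the ordered pair of distinct columns (j , punchIn j k);
-- flipPair encodes the same two columns in the opposite order.
flipPair : ∀ {m} → Fin (suc m) → Fin m → Fin (suc m) × Fin m
flipPair {suc m} zero    k       = suc k , zero
flipPair {suc m} (suc j) zero    = zero , j
flipPair {suc m} (suc j) (suc k) = Product.map suc suc (flipPair j k)

flipPair-first : ∀ {m} (j : Fin (suc m)) (k : Fin m) → proj₁ (flipPair j k) ≡ punchIn j k
flipPair-first {suc m} zero    k       = refl
flipPair-first {suc m} (suc j) zero    = refl
flipPair-first {suc m} (suc j) (suc k) = ≡.cong suc (flipPair-first j k)

flipPair-second : ∀ {m} (j : Fin (suc m)) (k : Fin m) → uncurry punchIn (flipPair j k) ≡ j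
flipPair-second {suc m} zero    k       = refl
flipPair-second {suc m} (suc j) zero    = refl
flipPair-second {suc m} (suc j) (suc k) = ≡.cong suc (flipPair-second j k)

flipPair-punchIn² : ∀ {m} (j : Fin (suc (suc m))) (k : Fin (suc m)) (x : Fin m) →
                    punchIn (proj₁ (flipPair j k)) (punchIn (proj₂ (flipPair j k)) x) ≡ punchIn j (punchIn k x)
flipPair-punchIn² zero    k       x = refl
flipPair-punchIn² (suc j) zero    x = refl
flipPair-punchIn² {suc m} (suc j) (suc k) zero    = refl
flipPair-punchIn² {suc m} (suc j) (suc k) (suc x) = ≡.cong suc (flipPair-punchIn² j k x)

∸-comm : ∀ n a b → n ∸ a ∸ b ≡ n ∸ b ∸ a
∸-comm n a b = begin
  n ∸ a ∸ b     ≡⟨ ℕ.∸-+-assoc n a b ⟩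
  n ∸ (a ℕ.+ b) ≡⟨ ≡.cong (n ∸_) (ℕ.+-comm a b) ⟩
  n ∸ (b ℕ.+ a) ≡⟨ ℕ.∸-+-assoc n b a ⟨
  n ∸ b ∸ a     ∎
  where open ≡.≡-Reasoning

<ᵇ-∸ : ∀ a b n → a ℕ.≤ n → (a ℕ.+ b <ᵇ suc n) ≡ (b <ᵇ suc (n ∸ a))
<ᵇ-∸ zero    b n       _         = refl
<ᵇ-∸ (suc a) b (suc n) (s≤s a≤n) = <ᵇ-∸ a b n a≤n

module _ {c r : Level} (R : CommutativeRing c r) where
  open CommutativeRing R hiding (zero) renaming (Carrier to A; refl to ≈-refl)
  open import Algebra.Properties.Ring ring using (-‿distribˡ-*; -‿distribʳ-*; -1*x≈-x; -‿involutive; -0#≈0#)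
  open import Algebra.Properties.Semiring.Sum semiring
    using (sum; sum-cong-≋; ∑-distrib-+; ∑-comm; *-distribˡ-sum; sum-replicate-zero)
  open import Relation.Binary.Reasoning.Setoid setoid
  module +-Solver = CommutativeMonoidSolver +-commutativeMonoid
  module *-Solver = CommutativeMonoidSolver *-commutativeMonoid

  sumFin≡sum : ∀ n (f : Fin n → A) → sumFin R n f ≡ sum f
  sumFin≡sum zero    f = refl
  sumFin≡sum (suc n) f = ≡.cong (λ s → f zero + s) (sumFin≡sum n (f ∘ suc))

  -‿distrib-sum : ∀ {n} (f : Fin n → A) → - sum f ≈ sum (λ k → - f k)
  -‿distrib-sum f = begin
    - sum f                ≈⟨ -1*x≈-x (sum f) ⟨
    - 1# * sum f           ≈⟨ *-distribˡ-sum (- 1#) f ⟩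
    sum (λ k → - 1# * f k) ≈⟨ sum-cong-≋ (λ k → -1*x≈-x (f k)) ⟩
    sum (λ k → - f k)      ∎

  -x*-y≈x*y : ∀ x y → - x * - y ≈ x * y
  -x*-y≈x*y x y = begin
    - x * - y   ≈⟨ -‿distribˡ-* x (- y) ⟨
    - (x * - y) ≈⟨ -‿cong (-‿distribʳ-* x y) ⟨
    - - (x * y) ≈⟨ -‿involutive (x * y) ⟩
    x * y       ∎

  sgn : ∀ {n} → Fin n → A
  sgn k = sign R (toℕ k)

  sgn-flipPair : ∀ {m} (j : Fin (suc m)) (k : Fin m) →
                 uncurry (λ a b → sgn a * sgn b) (flipPair j k) ≈ - (sgn j * sgn k)
  sgn-flipPair {suc m} zero k = begin
    - sgn k * 1#   ≈⟨ *-identityʳ _ ⟩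
    - sgn k        ≈⟨ -‿cong (*-identityˡ _) ⟨
    - (1# * sgn k) ∎
  sgn-flipPair {suc m} (suc j) zero = begin
    1# * sgn j       ≈⟨ *-identityˡ _ ⟩
    sgn j            ≈⟨ -‿involutive _ ⟨
    - - sgn j        ≈⟨ -‿cong (*-identityʳ _) ⟨
    - (- sgn j * 1#) ∎
  sgn-flipPair {suc m} (suc j) (suc k) = begin
    - sgn a * - sgn b     ≈⟨ -x*-y≈x*y (sgn a) (sgn b) ⟩
    sgn a * sgn b         ≈⟨ sgn-flipPair j k ⟩
    - (sgn j * sgn k)     ≈⟨ -‿cong (-x*-y≈x*y (sgn j) (sgn k)) ⟨
    - (- sgn j * - sgn k) ∎
    where a = proj₁ (flipPair j k); b = proj₂ (flipPair j k)

  ∑∑-flipPair : ∀ m (F : Fin (suc m) → Fin m → A) →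
                sum (λ j → sum (λ k → uncurry F (flipPair j k))) ≈ sum (λ j → sum (λ k → F j k))
  ∑∑-flipPair zero    F = ≈-refl
  ∑∑-flipPair (suc m) F = begin
    column + sum (λ j → F zero j + flipped j)
      ≈⟨ +-congˡ (∑-distrib-+ (F zero) flipped) ⟩
    column + (row + sum flipped)
      ≈⟨ +-congˡ (+-congˡ (∑∑-flipPair m (λ j k → F (suc j) (suc k)))) ⟩
    column + (row + rest)
      ≈⟨ +-Solver.solve 3 (λ x y z → x ⊕ (y ⊕ z) ⊜ y ⊕ (x ⊕ z)) ≈-refl column row rest ⟩
    row + (column + rest)
      ≈⟨ +-congˡ (∑-distrib-+ (λ j → F (suc j) zero) (λ j → sum (λ k → F (suc j) (suc k)))) ⟨
    row + sum (λ j → F (suc j) zero + sum (λ k → F (suc j) (suc k))) ∎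
    where
    open +-Solver using (_⊕_; _⊜_)
    column = sum (λ k → F (suc k) zero)
    row = sum (F zero)
    flipped = λ j → sum (λ k → uncurry F (flipPair (suc j) (suc k)))
    rest = sum (λ j → sum (λ k → F (suc j) (suc k)))

  minor : ∀ {n} → (Fin (suc n) → Fin (suc n) → A) → Fin (suc n) → Fin n → Fin n → A
  minor M j r k = M (suc r) (punchIn j k)

  det-laplace : ∀ n (M : Fin (suc n) → Fin (suc n) → A) →
                det R (suc n) M ≡ sum (λ j → sgn j * (M zero j * det R n (minor M j)))
  det-laplace n M = sumFin≡sum (suc n) (λ j → sgn j * (M zero j * det R n (minor M j)))

  det-cong : ∀ n {M N : Fin n → Fin n → A} → (∀ r k → M r k ≈ N r k) → det R n M ≈ det R n N
  det-cong zero    M≈N = ≈-refl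
  det-cong (suc n) {M} {N} M≈N = begin
    det R (suc n) M
      ≡⟨ det-laplace n M ⟩
    sum (λ j → sgn j * (M zero j * det R n (minor M j)))
      ≈⟨ sum-cong-≋ (λ j → *-congˡ {sgn j} (*-cong (M≈N zero j) (det-cong n (λ r k → M≈N (suc r) (punchIn j k))))) ⟩
    sum (λ j → sgn j * (N zero j * det R n (minor N j)))
      ≡⟨ det-laplace n N ⟨
    det R (suc n) N ∎

  det-cong-≡ : ∀ n {M N : Fin n → Fin n → A} → (∀ r k → M r k ≡ N r k) → det R n M ≈ det R n N
  det-cong-≡ n M≡N = det-cong n (λ r k → reflexive (M≡N r k))

  laplaceTerm₂ : ∀ {n} → (Fin (suc (suc n)) → Fin (suc (suc n)) → A) → Fin (suc (suc n)) → Fin (suc n) → A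
  laplaceTerm₂ {n} M j k =
    (sgn j * sgn k) * ((M zero j * M (suc zero) (punchIn j k)) * det R n (minor (minor M j) k))

  det-laplace₂ : ∀ n (M : Fin (suc (suc n)) → Fin (suc (suc n)) → A) →
                 det R (suc (suc n)) M ≈ sum (λ j → sum (λ k → laplaceTerm₂ M j k))
  det-laplace₂ n M = begin
    det R (suc (suc n)) M                                         ≡⟨ det-laplace (suc n) M ⟩
    sum (λ j → sgn j * (M zero j * det R (suc n) (minor M j)))     ≈⟨ sum-cong-≋ expandRow ⟩
    sum (λ j → sum (λ k → laplaceTerm₂ M j k))                    ∎
    where
    regroup : ∀ x a y b d → x * (a * (y * (b * d))) ≈ (x * y) * ((a * b) * d)
    regroup = *-Solver.solve 5 (λ x a y b d → x ⊕ (a ⊕ (y ⊕ (b ⊕ d))) ⊜ (x ⊕ y) ⊕ ((a ⊕ b) ⊕ d)) ≈-refl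
      where open *-Solver using (_⊕_; _⊜_)
    expandRow : ∀ j → sgn j * (M zero j * det R (suc n) (minor M j)) ≈ sum (laplaceTerm₂ M j)
    expandRow j = begin
      sgn j * (M zero j * det R (suc n) (minor M j))
        ≡⟨ ≡.cong (λ d → sgn j * (M zero j * d)) (det-laplace n (minor M j)) ⟩
      sgn j * (M zero j * sum secondRow)
        ≈⟨ *-congˡ (*-distribˡ-sum (M zero j) secondRow) ⟩
      sgn j * sum (λ k → M zero j * secondRow k)
        ≈⟨ *-distribˡ-sum (sgn j) (λ k → M zero j * secondRow k) ⟩
      sum (λ k → sgn j * (M zero j * secondRow k))
        ≈⟨ sum-cong-≋ (λ k → regroup (sgn j) (M zero j) (sgn k) (M (suc zero) (punchIn j k))
                                     (det R n (minor (minor M j) k))) ⟩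
      sum (laplaceTerm₂ M j) ∎
      where
      secondRow : Fin (suc n) → A
      secondRow k = sgn k * (M (suc zero) (punchIn j k) * det R n (minor (minor M j) k))

  laplaceTerm₂-flipPair : ∀ {n} (M : Fin (suc (suc n)) → Fin (suc (suc n)) → A) j k →
    uncurry (laplaceTerm₂ (λ r → M (transp zero (suc zero) r))) (flipPair j k) ≈ - laplaceTerm₂ M j k
  laplaceTerm₂-flipPair {n} M j k = begin
    (sgn a * sgn b) * ((M (suc zero) a * M zero (punchIn a b)) * det R n (minor (minor M′ a) b))
      ≈⟨ *-cong (sgn-flipPair j k)
           (*-cong (*-cong (reflexive (≡.cong (M (suc zero)) (flipPair-first j k)))
                           (reflexive (≡.cong (M zero) (flipPair-second j k))))
                   (det-cong-≡ n (λ r x → ≡.cong (M (suc (suc r))) (flipPair-punchIn² j k x)))) ⟩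
    - (sgn j * sgn k) * ((M (suc zero) (punchIn j k) * M zero j) * det R n (minor (minor M j) k))
      ≈⟨ -‿distribˡ-* _ _ ⟨
    - ((sgn j * sgn k) * ((M (suc zero) (punchIn j k) * M zero j) * det R n (minor (minor M j) k)))
      ≈⟨ -‿cong (*-congˡ (*-congʳ (*-comm _ _))) ⟩
    - laplaceTerm₂ M j k ∎
    where
    M′ = λ r → M (transp zero (suc zero) r)
    a = proj₁ (flipPair j k)
    b = proj₂ (flipPair j k)

  det-swap₀₁ : ∀ n (M : Fin (suc (suc n)) → Fin (suc (suc n)) → A) →
               det R (suc (suc n)) (λ r → M (transp zero (suc zero) r)) ≈ - det R (suc (suc n)) M
  det-swap₀₁ n M = begin
    det R (suc (suc n)) M′                                    ≈⟨ det-laplace₂ n M′ ⟩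
    sum (λ j → sum (λ k → laplaceTerm₂ M′ j k))               ≈⟨ ∑∑-flipPair (suc n) (laplaceTerm₂ M′) ⟨
    sum (λ j → sum (λ k → uncurry (laplaceTerm₂ M′) (flipPair j k)))
      ≈⟨ sum-cong-≋ (λ j → sum-cong-≋ (laplaceTerm₂-flipPair M j)) ⟩
    sum (λ j → sum (λ k → - laplaceTerm₂ M j k))              ≈⟨ sum-cong-≋ (λ j → -‿distrib-sum (laplaceTerm₂ M j)) ⟨
    sum (λ j → - sum (λ k → laplaceTerm₂ M j k))              ≈⟨ -‿distrib-sum (λ j → sum (laplaceTerm₂ M j)) ⟨
    - sum (λ j → sum (λ k → laplaceTerm₂ M j k))              ≈⟨ -‿cong (det-laplace₂ n M) ⟨
    - det R (suc (suc n)) M                                   ∎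
    where M′ = λ r → M (transp zero (suc zero) r)

  det-transp : ∀ n {i j : Fin n} → toℕ j ≡ suc (toℕ i) → (M : Fin n → Fin n → A) →
               det R n (λ r → M (transp i j r)) ≈ - det R n M
  det-transp (suc (suc n)) {zero}  {suc zero} _ M = det-swap₀₁ n M
  det-transp (suc n)       {suc i} {suc j} j≡1+i M = begin
    det R (suc n) (λ r → M (transp (suc i) (suc j) r))
      ≡⟨ det-laplace n (λ r → M (transp (suc i) (suc j) r)) ⟩
    sum (λ c → sgn c * (M zero c * det R n (λ r k → M (transp (suc i) (suc j) (suc r)) (punchIn c k))))
      ≈⟨ sum-cong-≋ (λ c → *-congˡ {sgn c} (*-congˡ {M zero c}
           (det-cong-≡ n (λ r k → ≡.cong (λ q → M q (punchIn c k)) (transp-suc i j r))))) ⟩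
    sum (λ c → sgn c * (M zero c * det R n (λ r → minor M c (transp i j r))))
      ≈⟨ sum-cong-≋ (λ c → *-congˡ {sgn c} (*-congˡ {M zero c}
           (det-transp n (ℕ.suc-injective j≡1+i) (minor M c)))) ⟩
    sum (λ c → sgn c * (M zero c * - det R n (minor M c)))
      ≈⟨ sum-cong-≋ (λ c → pushNeg (sgn c) (M zero c) (det R n (minor M c))) ⟩
    sum (λ c → - (sgn c * (M zero c * det R n (minor M c))))
      ≈⟨ -‿distrib-sum (λ c → sgn c * (M zero c * det R n (minor M c))) ⟨
    - sum (λ c → sgn c * (M zero c * det R n (minor M c)))
      ≡⟨ ≡.cong -_ (det-laplace n M) ⟨
    - det R (suc n) M ∎
    where
    pushNeg : ∀ x y z → x * (y * - z) ≈ - (x * (y * z))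
    pushNeg x y z = trans (*-congˡ (sym (-‿distribʳ-* y z))) (sym (-‿distribʳ-* x (y * z)))

  schur-straighten : (h : ℕ → A) (ℓ : ℕ) {i j : Fin ℓ} → toℕ j ≡ suc (toℕ i) → ∀ γ →
                     schur R h ℓ (straighten i j γ) ≈ - schur R h ℓ γ
  schur-straighten h ℓ j≡1+i γ =
    trans (det-cong-≡ ℓ (λ r c → ≡.cong (hℤ R h) (jtIndex-straighten j≡1+i γ r c)))
          (det-transp ℓ j≡1+i (λ r c → hℤ R h (jtIndex γ r c)))

  schur-cong : (h : ℕ → A) (ℓ : ℕ) {γ γ′ : Fin ℓ → ℤ} → (∀ x → γ x ≡ γ′ x) →
               schur R h ℓ γ ≈ schur R h ℓ γ′
  schur-cong h ℓ γ≗γ′ =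
    det-cong-≡ ℓ (λ r c → ≡.cong (λ g → hℤ R h (g ℤ.+ + toℕ c ℤ.- + toℕ r)) (γ≗γ′ r))

  sum≤ : ℕ → (ℕ → A) → A
  sum≤ n f = sum (λ (a : Fin (suc n)) → f (toℕ a))

  sum≤-cong : ∀ n {f g : ℕ → A} → (∀ a → f a ≈ g a) → sum≤ n f ≈ sum≤ n g
  sum≤-cong n f≈g = sum-cong-≋ {suc n} (λ a → f≈g (toℕ a))

  sum≤-truncate : ∀ {k m} → k ℕ.≤ m → (f : ℕ → A) →
                  sum≤ m (λ b → if b <ᵇ suc k then f b else 0#) ≈ sum≤ k f
  sum≤-truncate {zero}  {m}     _         f = +-congˡ (sum-replicate-zero m)
  sum≤-truncate {suc k} {suc m} (s≤s k≤m) f = +-congˡ (sum≤-truncate k≤m (f ∘ suc))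

  sum≤-triangle-square : ∀ n (g : ℕ → ℕ → A) →
    sum≤ n (λ a → sum≤ (n ∸ a) (g a)) ≈ sum≤ n (λ a → sum≤ n (λ b → if a ℕ.+ b <ᵇ suc n then g a b else 0#))
  sum≤-triangle-square n g = sum-cong-≋ {suc n} λ a → begin
    sum≤ (n ∸ toℕ a) (g (toℕ a))
      ≈⟨ sum≤-truncate (ℕ.m∸n≤m n (toℕ a)) (g (toℕ a)) ⟨
    sum≤ n (λ b → if b <ᵇ suc (n ∸ toℕ a) then g (toℕ a) b else 0#)
      ≈⟨ sum≤-cong n (λ b → reflexive (≡.cong (λ t → if t then g (toℕ a) b else 0#)
                                         (≡.sym (<ᵇ-∸ (toℕ a) b n (Fin.toℕ≤pred[n] a))))) ⟩
    sum≤ n (λ b → if toℕ a ℕ.+ b <ᵇ suc n then g (toℕ a) b else 0#) ∎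

  sum≤-triangle-comm : ∀ n (g : ℕ → ℕ → A) →
    sum≤ n (λ a → sum≤ (n ∸ a) (g a)) ≈ sum≤ n (λ a → sum≤ (n ∸ a) (λ b → g b a))
  sum≤-triangle-comm n g = begin
    sum≤ n (λ a → sum≤ (n ∸ a) (g a))
      ≈⟨ sum≤-triangle-square n g ⟩
    sum≤ n (λ a → sum≤ n (λ b → if a ℕ.+ b <ᵇ suc n then g a b else 0#))
      ≈⟨ ∑-comm {suc n} {suc n} (λ a b → if toℕ a ℕ.+ toℕ b <ᵇ suc n then g (toℕ a) (toℕ b) else 0#) ⟩
    sum≤ n (λ b → sum≤ n (λ a → if a ℕ.+ b <ᵇ suc n then g a b else 0#))
      ≈⟨ sum≤-cong n (λ b → sum≤-cong n (λ a →
           reflexive (≡.cong (λ t → if t <ᵇ suc n then g a b else 0#) (ℕ.+-comm a b)))) ⟩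
    sum≤ n (λ b → sum≤ n (λ a → if b ℕ.+ a <ᵇ suc n then g a b else 0#))
      ≈⟨ sum≤-triangle-square n (λ b a → g a b) ⟨
    sum≤ n (λ a → sum≤ (n ∸ a) (λ b → g b a)) ∎

  sumList-++ : ∀ xs ys → sumList R (xs ++ ys) ≈ sumList R xs + sumList R ys
  sumList-++ []       ys = sym (+-identityˡ _)
  sumList-++ (x ∷ xs) ys = trans (+-congˡ (sumList-++ xs ys)) (sym (+-assoc _ _ _))

  sumList-map-cong : ∀ {X : Set} (xs : List X) {f g : X → A} → (∀ x → f x ≈ g x) →
                     sumList R (map f xs) ≈ sumList R (map g xs)
  sumList-map-cong []       f≈g = ≈-refl
  sumList-map-cong (x ∷ xs) f≈g = +-cong (f≈g x) (sumList-map-cong xs f≈g)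

  sumList-map-concatMap : ∀ {X Y : Set} (g : Y → A) (f : X → List Y) xs →
    sumList R (map g (concatMap f xs)) ≈ sumList R (map (λ x → sumList R (map g (f x))) xs)
  sumList-map-concatMap g f []       = ≈-refl
  sumList-map-concatMap g f (x ∷ xs) = begin
    sumList R (map g (f x ++ concatMap f xs))
      ≡⟨ ≡.cong (sumList R) (List.map-++ g (f x) (concatMap f xs)) ⟩
    sumList R (map g (f x) ++ map g (concatMap f xs))
      ≈⟨ sumList-++ (map g (f x)) (map g (concatMap f xs)) ⟩
    sumList R (map g (f x)) + sumList R (map g (concatMap f xs))
      ≈⟨ +-congˡ (sumList-map-concatMap g f xs) ⟩
    sumList R (map (λ x → sumList R (map g (f x))) (x ∷ xs)) ∎

  sumList-map-applyUpTo : ∀ (f : ℕ → A) (g : ℕ → ℕ) m →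
                          sumList R (map f (applyUpTo g m)) ≡ sum (λ (a : Fin m) → f (g (toℕ a)))
  sumList-map-applyUpTo f g zero    = refl
  sumList-map-applyUpTo f g (suc m) = ≡.cong (λ s → f (g 0) + s) (sumList-map-applyUpTo f (g ∘ suc) m)

  -- coeff F rs γ n is the t^n-coefficient of ∏_{(a,b) ∈ rs} (1 − t z_a/z_b)⁻¹ z^γ after
  -- applying z^β ↦ F β; for F = schur and rs = rootsOf Ψ it is coeffH.
  module _ {ℓ : ℕ} (F : (Fin ℓ → ℤ) → A) (F-cong : ∀ {γ γ′} → (∀ x → γ x ≡ γ′ x) → F γ ≈ F γ′) where

    coeff : List (Fin ℓ × Fin ℓ) → (Fin ℓ → ℤ) → ℕ → A
    coeff rs γ n = sumList R (map (λ v → F (shiftBy rs v γ)) (compositions (length rs) n))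

    coeff-cong : ∀ rs {γ γ′} → (∀ x → γ x ≡ γ′ x) → ∀ n → coeff rs γ n ≈ coeff rs γ′ n
    coeff-cong rs γ≗γ′ n =
      sumList-map-cong (compositions (length rs) n) (λ v → F-cong (shiftBy-cong rs v γ≗γ′))

    coeff-∷ : ∀ r rs γ n → coeff (r ∷ rs) γ n ≈ sum≤ n (λ a → coeff rs (shift r a γ) (n ∸ a))
    coeff-∷ r rs γ n = begin
      coeff (r ∷ rs) γ n
        ≈⟨ sumList-map-concatMap term prepended (upTo (suc n)) ⟩
      sumList R (map (λ a → sumList R (map term (prepended a))) (upTo (suc n)))
        ≡⟨ sumList-map-applyUpTo (λ a → sumList R (map term (prepended a))) id (suc n) ⟩
      sum≤ n (λ a → sumList R (map term (prepended a)))
        ≈⟨ sum≤-cong n (λ a → reflexive (≡.cong (sumList R)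
             (≡.sym (List.map-∘ {g = term} {f = a ∷_} (compositions (length rs) (n ∸ a)))))) ⟩
      sum≤ n (λ a → coeff rs (shift r a γ) (n ∸ a)) ∎
      where
      term = λ v → F (shiftBy (r ∷ rs) v γ)
      prepended = λ a → map (a ∷_) (compositions (length rs) (n ∸ a))

    coeff-prep : ∀ r {rs rs′} → (∀ γ n → coeff rs γ n ≈ coeff rs′ γ n) →
                 ∀ γ n → coeff (r ∷ rs) γ n ≈ coeff (r ∷ rs′) γ n
    coeff-prep r {rs} {rs′} same γ n = begin
      coeff (r ∷ rs) γ n                              ≈⟨ coeff-∷ r rs γ n ⟩
      sum≤ n (λ a → coeff rs (shift r a γ) (n ∸ a))   ≈⟨ sum≤-cong n (λ a → same (shift r a γ) (n ∸ a)) ⟩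
      sum≤ n (λ a → coeff rs′ (shift r a γ) (n ∸ a))  ≈⟨ coeff-∷ r rs′ γ n ⟨
      coeff (r ∷ rs′) γ n                             ∎

    coeff-swap : ∀ r s rs γ n → coeff (r ∷ s ∷ rs) γ n ≈ coeff (s ∷ r ∷ rs) γ n
    coeff-swap r s rs γ n = begin
      coeff (r ∷ s ∷ rs) γ n
        ≈⟨ coeff-∷ r (s ∷ rs) γ n ⟩
      sum≤ n (λ a → coeff (s ∷ rs) (shift r a γ) (n ∸ a))
        ≈⟨ sum≤-cong n (λ a → coeff-∷ s rs (shift r a γ) (n ∸ a)) ⟩
      sum≤ n (λ a → sum≤ (n ∸ a) (λ b → coeff rs (shift s b (shift r a γ)) (n ∸ a ∸ b)))
        ≈⟨ sum≤-triangle-comm n (λ a b → coeff rs (shift s b (shift r a γ)) (n ∸ a ∸ b)) ⟩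
      sum≤ n (λ a → sum≤ (n ∸ a) (λ b → coeff rs (shift s a (shift r b γ)) (n ∸ b ∸ a)))
        ≈⟨ sum≤-cong n (λ a → sum≤-cong (n ∸ a) (λ b → trans
             (coeff-cong rs (shift-comm s r a b γ) (n ∸ b ∸ a))
             (reflexive (≡.cong (coeff rs (shift r b (shift s a γ))) (∸-comm n b a))))) ⟩
      sum≤ n (λ a → sum≤ (n ∸ a) (λ b → coeff rs (shift r b (shift s a γ)) (n ∸ a ∸ b)))
        ≈⟨ sum≤-cong n (λ a → coeff-∷ r rs (shift s a γ) (n ∸ a)) ⟨
      sum≤ n (λ a → coeff (r ∷ rs) (shift s a γ) (n ∸ a))
        ≈⟨ coeff-∷ s (r ∷ rs) γ n ⟨
      coeff (s ∷ r ∷ rs) γ n ∎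

    coeff-↭ : ∀ {rs rs′} → rs ↭ rs′ → ∀ γ n → coeff rs γ n ≈ coeff rs′ γ n
    coeff-↭ ↭.refl                         γ n = ≈-refl
    coeff-↭ (↭.prep {rs} {rs′} r rs↭rs′)   γ n = coeff-prep r {rs} {rs′} (coeff-↭ rs↭rs′) γ n
    coeff-↭ (↭.swap {rs} {rs′} r s rs↭rs′) γ n =
      trans (coeff-swap r s rs γ n)
            (coeff-prep s {r ∷ rs} {r ∷ rs′} (coeff-prep r {rs} {rs′} (coeff-↭ rs↭rs′)) γ n)
    coeff-↭ (↭.trans rs↭rs″ rs″↭rs′)       γ n = trans (coeff-↭ rs↭rs″ γ n) (coeff-↭ rs″↭rs′ γ n)

    coeff-straighten : ∀ {i j : Fin ℓ} → (∀ γ → F (straighten i j γ) ≈ - F γ) →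
                       ∀ rs γ n → coeff rs (straighten i j γ) n ≈ - coeff (map (transp² i j) rs) γ n
    coeff-straighten {i} {j} F-straighten [] γ zero = begin
      F (straighten i j γ) + 0#   ≈⟨ +-identityʳ _ ⟩
      F (straighten i j γ)        ≈⟨ F-straighten γ ⟩
      - F γ                       ≈⟨ -‿cong (+-identityʳ _) ⟨
      - (F γ + 0#)                ∎
    coeff-straighten F-straighten [] γ (suc n) = sym -0#≈0#
    coeff-straighten {i} {j} F-straighten (r ∷ rs) γ n = begin
      coeff (r ∷ rs) (straighten i j γ) n
        ≈⟨ coeff-∷ r rs (straighten i j γ) n ⟩
      sum≤ n (λ a → coeff rs (shift r a (straighten i j γ)) (n ∸ a))
        ≈⟨ sum≤-cong n (λ a → coeff-cong rs (shift-straighten i j r a γ) (n ∸ a)) ⟩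
      sum≤ n (λ a → coeff rs (straighten i j (shift r′ a γ)) (n ∸ a))
        ≈⟨ sum≤-cong n (λ a → coeff-straighten {i} {j} F-straighten rs (shift r′ a γ) (n ∸ a)) ⟩
      sum≤ n (λ a → - coeff rs′ (shift r′ a γ) (n ∸ a))
        ≈⟨ -‿distrib-sum {suc n} (λ a → coeff rs′ (shift r′ (toℕ a) γ) (n ∸ toℕ a)) ⟨
      - sum≤ n (λ a → coeff rs′ (shift r′ a γ) (n ∸ a))
        ≈⟨ -‿cong (coeff-∷ r′ rs′ γ n) ⟨
      - coeff (r′ ∷ rs′) γ n ∎
      where
      r′ = transp² i j r
      rs′ = map (transp² i j) rs

map-transp²-rootsOf : ∀ {ℓ} (Ψ : Subset² ℓ) (i j : Fin ℓ) →
                      (∀ x y → Ψ (transp i j x) (transp i j y) ≡ Ψ x y) →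
                      map (transp² i j) (rootsOf Ψ) ↭ rootsOf Ψ
map-transp²-rootsOf {ℓ} Ψ i j Ψ-invariant =
  ∼bag⇒↭ (unique∧set⇒bag (Unique.map⁺ injective rootsOf-unique) rootsOf-unique (mk⇔ to from))
  where
  isRoot : Fin ℓ × Fin ℓ → Bool
  isRoot (a , b) = Ψ a b

  rootsOf-unique = Unique.filter⁺ (T? ∘ isRoot)
                     (Unique.cartesianProduct⁺ (Unique.allFin⁺ ℓ) (Unique.allFin⁺ ℓ))

  injective : ∀ {r s} → transp² i j r ≡ transp² i j s → r ≡ s
  injective {r} {s} eq = ≡.trans (≡.sym (transp²-involutive i j r))
                           (≡.trans (≡.cong (transp² i j) eq) (transp²-involutive i j s))

  transp²-∈ : ∀ {r} → r ∈ rootsOf Ψ → transp² i j r ∈ rootsOf Ψ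
  transp²-∈ {a , b} r∈ =
    ∈-filter⁺ (T? ∘ isRoot) (∈-cartesianProduct⁺ (∈-allFin _) (∈-allFin _))
      (≡.subst T (≡.sym (Ψ-invariant a b))
        (proj₂ (∈-filter⁻ (T? ∘ isRoot) {xs = cartesianProduct (allFin ℓ) (allFin ℓ)} r∈)))

  to : ∀ {r} → r ∈ map (transp² i j) (rootsOf Ψ) → r ∈ rootsOf Ψ
  to r∈ with ∈-map⁻ (transp² i j) r∈
  ... | _ , s∈ , refl = transp²-∈ s∈

  from : ∀ {r} → r ∈ rootsOf Ψ → r ∈ map (transp² i j) (rootsOf Ψ)
  from {r} r∈ = ≡.subst (_∈ map (transp² i j) (rootsOf Ψ)) (transp²-involutive i j r)
                  (∈-map⁺ (transp² i j) (transp²-∈ r∈))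

lemma6p1 : ∀ {c r : Level} (ℓ : ℕ) (Ψ : Subset² ℓ) → IsRootIdeal Ψ →
    (i i+1 : Fin ℓ) → toℕ i+1 ≡ suc (toℕ i) →
    (∀ x y → Ψ (transp i i+1 x) (transp i i+1 y) ≡ Ψ x y) →
    (γ : Fin ℓ → ℤ) →
    (R : CommutativeRing c r) (h : ℕ → CommutativeRing.Carrier R) →
    CommutativeRing._≈_ R (h 0) (CommutativeRing.1# R) →
    (n : ℕ) →
    CommutativeRing._≈_ R
      (CommutativeRing._+_ R
        (coeffH R h ℓ Ψ γ n)
        (coeffH R h ℓ Ψ (λ x → ε i+1 x ℤ.- ε i x ℤ.+ γ (transp i i+1 x)) n))
      (CommutativeRing.0# R)
lemma6p1 ℓ Ψ _ i i+1 i+1≡1+i Ψ-invariant γ R h _ n = begin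
  coeffH R h ℓ Ψ γ n + coeffH R h ℓ Ψ (straighten i i+1 γ) n
    ≈⟨ +-congˡ (coeff-straighten R F F-cong (schur-straighten R h ℓ i+1≡1+i) roots γ n) ⟩
  coeffH R h ℓ Ψ γ n + - coeff R F F-cong (map (transp² i i+1) roots) γ n
    ≈⟨ +-congˡ (-‿cong (coeff-↭ R F F-cong (map-transp²-rootsOf Ψ i i+1 Ψ-invariant) γ n)) ⟩
  coeffH R h ℓ Ψ γ n + - coeffH R h ℓ Ψ γ n
    ≈⟨ -‿inverseʳ _ ⟩
  0# ∎
  where
  open CommutativeRing R
  open import Relation.Binary.Reasoning.Setoid setoid
  F = schur R h ℓ
  F-cong = schur-cong R h ℓ
  roots = rootsOf Ψ
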